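{- Let $X,Y,Z$ be $R^+$-spaces. For all $s\in P(X\multimap Y)$ and $t\in P(Y\multimap Z)$, the matrix product $t\cdot s$ is well-defined and belongs to $P(X\multimap Z)$. Moreover the identity matrix $\mathrm{id}_X\in (R^+)^{|X|\times|X|}$, $(\mathrm{id}_X)_{a,a'}=\delta_{a,a'}$, belongs to $P(X\multimap X)$. Consequently there is a category whose objects are $R^+$-spaces, whose morphisms $X\to Y$ are the elements of $P(X\multimap Y)$, and whose composition is matrix multiplication.
   Context: Partial commutative monoid (PCM): a nonempty set $M$ with a partial sum $\Sigma$ on countably indexed families (those in its domain are "summable") such that (Unary) every singleton family $(x)$ is summable with sum $x$, and (WPA) for a summable $(x_a)_{a\in A}$ and a partition $\{A_i\}_{i\in I}$ ($I$ countable, parts possibly empty), each $(x_a)_{a\in A_i}$ is summable, $(\sum_{a\in A_i}x_a)_i$ is summable and has sum $\sum_{a\in A}x_a$. It is strong if also (PA): whenever each $(x_a)_{a\in A_i}$ is summable and $(\sum_{a\in A_i}x_a)_i$ is summable, then $(x_a)_{a\in A}$ is summable. $0$ is the sum of the empty family; $x\le y$ iff $x+z=y$ for some $z$. A partial commutative rig (PCR) $(R,\Sigma,1,\cdot)$ is a PCM $(R,\Sigma)$ with a commutative monoid $(R,1,\cdot)$ such that whenever $(x_a)_{a\in A}$ and $(y_b)_{b\in B}$ are summable, $(x_ay_b)_{(a,b)\in A\times B}$ is summable with sum $(\sum_a x_a)(\sum_b y_b)$; it is strong if its PCM is strong. Standing setting: $R^+$ is a strong PCR and $\mathcal B\subseteq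 R^+$ is downward closed ($x\le y\in\mathcal B$ implies $x\in\mathcal B$). Webs are countable sets. For a web $W$, vectors are elements of $(R^+)^W$. The (partial) scalar product is $\langle x,y\rangle=\sum_{a\in W}x_ay_a$; $x\perp y$ means $\langle x,y\rangle$ is defined and lies in $\mathcal B$; for $F\subseteq (R^+)^W$, $F^\perp=\{y\mid \forall x\in F,\ x\perp y\}$. A covering is a set $F\subseteq (R^+)^W$ such that for every $a\in W$ some $x\in F$ has $x_a$ invertible in $(R^+,1,\cdot)$. An $R^+$-space is a pair $X=(|X|,P(X))$ with $|X|$ a web, $P(X)\subseteq (R^+)^{|X|}$, $P(X)^{\perp\perp}=P(X)$, and both $P(X)$ and $P(X)^\perp$ coverings; its dual is $X^\perp=(|X|,P(X)^\perp)$. For $x\in (R^+)^{|X|},y\in(R^+)^{|Y|}$, $x\otimes y\in (R^+)^{|X|\times|Y|}$ is $(x\otimes y)_{a,b}=x_ay_b$, and $F\otimes G=\{x\otimes y\mid x\in F,y\in G\}$. $X\otimes Y=(|X|\times|Y|,(P(X)\otimes P(Y))^{\perp\perp})$ and $X\multimap Y=(X\otimes Y^\perp)^\perp$. Matrix operations (partial, defined when all the component sums are defined): for $s\in (R^+)^{|X|\times|Y|}$, $t\in(R^+)^{|Y|\times|Z|}$, $(t\cdot s)_{a,c}=\sum_{b\in|Y|}s_{a,b}t_{b,c}$ and $(s\cdot x)_b=\sum_{a\in|X|}s_{a,b}x_a$. -}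

module Defs where

open import Data.Nat using (ℕ)
open import Data.Bool using (Bool; if_then_else_)
open import Data.Empty using (⊥; ⊥-elim)
open import Data.Product using (Σ; ∃; ∃-syntax; _×_; _,_; proj₁; proj₂)
open import Function.Definitions using (Injective)
open import Relation.Binary.PropositionalEquality using (_≡_; _≢_)
open import Algebra.Structures using (IsCommutativeMonoid)

Countable : Set → Set
Countable A = Σ (A → ℕ) (λ f → Injective _≡_ _≡_ f)

IsSingleton : Set → Set
IsSingleton A = Σ A (λ a → ∀ b → b ≡ a)

-- A partition {A_i}_{i∈I} of A (parts possibly empty) is given by the map
-- p : A → I sending each element to the index of its part; the part A_i
-- is the fibre of p over i.
Part : {A I : Set} → (A → I) → I → Set
Part {A} p i = Σ A (λ a → p a ≡ i)

-- Strong partial commutative rig.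
-- The partial sum Σ is given as a (functional) relation  Sum x m  meaning
-- "the family x is summable with sum m".

record StrongPCR : Set₁ where
  infixl 7 _·_
  field
    Carrier        : Set
    Sum            : {A : Set} → (A → Carrier) → Carrier → Set
    Sum-functional : ∀ {A} {x : A → Carrier} {m n : Carrier} →
                     Sum x m → Sum x n → m ≡ n
    Sum-ext        : ∀ {A} {x y : A → Carrier} {m : Carrier} →
                     (∀ a → x a ≡ y a) → Sum x m → Sum y m
    unary          : ∀ {A} (s : IsSingleton A) (x : A → Carrier) →
                     Sum x (x (proj₁ s))
    wpa            : ∀ {A I} → Countable A → Countable I →
                     (x : A → Carrier) {m : Carrier} → Sum x m →
                     (p : A → I) →
                     Σ (I → Carrier) λ s →
                       (∀ i → Sum (λ (q : Part p i) → x (proj₁ q)) (s i))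
                       × Sum s m
    pa             : ∀ {A I} → Countable A → Countable I →
                     (x : A → Carrier) (p : A → I) (s : I → Carrier) →
                     (∀ i → Sum (λ (q : Part p i) → x (proj₁ q)) (s i)) →
                     ∃[ m ] Sum s m →
                     ∃[ m ] Sum x m
    _·_            : Carrier → Carrier → Carrier
    one            : Carrier
    isCommMonoid   : IsCommutativeMonoid _≡_ _·_ one
    sum-mul        : ∀ {A B} → Countable A → Countable B →
                     {x : A → Carrier} {y : B → Carrier} {m n : Carrier} →
                     Sum x m → Sum y n →
                     Sum (λ (ab : A × B) → x (proj₁ ab) · y (proj₂ ab)) (m · n)

module _ (R : StrongPCR) where
  open StrongPCR R

  -- binary sum x + z = y  (family indexed by a two-element set)
  _≤_ : Carrier → Carrier → Set
  x ≤ y = ∃[ z ] Sum (λ (b : Bool) → if b then x else z) y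

  IsZero : Carrier → Set
  IsZero z = Sum {⊥} ⊥-elim z

  Invertible : Carrier → Set
  Invertible x = ∃[ y ] x · y ≡ one

  DownClosed : (Carrier → Set) → Set
  DownClosed 𝓑 = ∀ x y → x ≤ y → 𝓑 y → 𝓑 x

module _ (R : StrongPCR) (𝓑 : StrongPCR.Carrier R → Set) where
  open StrongPCR R

  Vect : Set → Set
  Vect W = W → Carrier

  Orth : {W : Set} → Vect W → Vect W → Set
  Orth x y = ∃[ m ] Sum (λ a → x a · y a) m × 𝓑 m

  Perp : {W : Set} → (Vect W → Set) → Vect W → Set
  Perp F y = ∀ x → F x → Orth x y

  Covering : {W : Set} → (Vect W → Set) → Set
  Covering F = ∀ a → ∃[ x ] F x × Invertible R (x a)

  record Space : Set₁ where
    field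
      Web          : Set
      web-count    : Countable Web
      P            : Vect Web → Set
      P⊆P⊥⊥        : ∀ x → P x → Perp (Perp P) x
      P⊥⊥⊆P        : ∀ x → Perp (Perp P) x → P x
      P-covering   : Covering P
      P⊥-covering  : Covering (Perp P)
  open Space public

  TensorSet : {V W : Set} → (Vect V → Set) → (Vect W → Set) → Vect (V × W) → Set
  TensorSet F G w = ∃[ x ] ∃[ y ] F x × G y × (∀ a b → w (a , b) ≡ x a · y b)

  PTensor : {V W : Set} → (Vect V → Set) → (Vect W → Set) → Vect (V × W) → Set
  PTensor F G = Perp (Perp (TensorSet F G))

  PLolli : (X Y : Space) → Vect (Web X × Web Y) → Set
  PLolli X Y = Perp (PTensor (P X) (Perp (P Y)))

  -- u = t · s  (all component sums defined, with values u)
  MatProd : {U V W : Set} → Vect (U × V) → Vect (V × W) → Vect (U × W) → Set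
  MatProd s t u = ∀ a c → Sum (λ b → s (a , b) · t (b , c)) (u (a , c))

  -- i is the identity matrix δ (0 being the sum of the empty family)
  IsIdMatrix : (W : Set) → Vect (W × W) → Set
  IsIdMatrix W i = ∀ a a' → (a ≡ a' → i (a , a') ≡ one)
                          × (a ≢ a' → IsZero R (i (a , a')))

module Submission where

-- A morphism s ∈ P(X ⊸ Y) is a matrix with ⟨x ⊗ y′, s⟩ ∈ 𝓑 for all x ∈ P(X), y′ ∈ P(Y)^⊥.
-- Applying (WPA) to ⟨x ⊗ y′, s⟩ splits it into the terms y′_b (s·x)_b, so (s·x)_b exists once
-- y′_b is invertible, which the covering P(Y)^⊥ provides; hence s·x ∈ P(Y)^⊥⊥ = P(Y).  For
-- z ∈ P(Z)^⊥, (PA) expands ⟨(s·x) ⊗ z, t⟩ ∈ 𝓑 into the summable family x_a z_c s_ab t_bc, and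
-- regrouping it by (a, c) yields both the entries of t·s (dividing by an invertible x_a z_c) and
-- ⟨x ⊗ z, t·s⟩ ∈ 𝓑.  The identity is a morphism since ⟨x ⊗ x′, δ⟩ = ⟨x, x′⟩.  The unit and
-- associativity laws hold for arbitrary matrices whose products are defined: (PA) sums
-- s_ab t_bc u_cd by rows, and (WPA) re-sums it by columns.

open import Defs
open import Algebra.Bundles using (CommutativeMonoid)
open import Algebra.Structures using (IsCommutativeMonoid)
open import Axiom.UniquenessOfIdentityProofs.WithK using (uip)
open import Data.Bool using (Bool; true; false; if_then_else_)
open import Data.Empty using (⊥; ⊥-elim)
open import Data.Nat using (ℕ; zero; suc; _*_)
open import Data.Nat.Properties using (suc-injective; *-cancelˡ-≡; even≢odd; eq?)
open import Data.Product using (∃; ∃-syntax; _×_; _,_; proj₁; proj₂; swap)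
open import Data.Product.Algebra using (×-comm)
open import Data.Unit using (⊤; tt)
open import Function using (_∘_; _↔_; Inverse; Injection; mk↔ₛ′; mk↣)
open import Function.Properties.Inverse using (↔-sym; ↔⇒↣)
open import Relation.Binary.Definitions using (DecidableEquality)
open import Relation.Binary.PropositionalEquality hiding (J)
open import Relation.Nullary using (¬_; Dec; yes; no; does)
open import Relation.Nullary.Decidable using (dec-true)

private
  variable
    A B C D I J : Set

⟪_,_⟫ : ℕ → ℕ → ℕ
⟪ zero  , n ⟫ = suc (2 * n)
⟪ suc m , n ⟫ = 2 * ⟪ m , n ⟫

⟪,⟫-injective : ∀ m n m′ n′ → ⟪ m , n ⟫ ≡ ⟪ m′ , n′ ⟫ → (m , n) ≡ (m′ , n′)
⟪,⟫-injective zero    n zero     n′ e = cong (0 ,_) (*-cancelˡ-≡ n n′ 2 (suc-injective e))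
⟪,⟫-injective zero    n (suc m′) n′ e = ⊥-elim (even≢odd ⟪ m′ , n′ ⟫ n (sym e))
⟪,⟫-injective (suc m) n zero     n′ e = ⊥-elim (even≢odd ⟪ m , n ⟫ n′ e)
⟪,⟫-injective (suc m) n (suc m′) n′ e =
  cong (λ (k , l) → suc k , l) (⟪,⟫-injective m n m′ n′ (*-cancelˡ-≡ _ _ 2 e))

countable-⊥ : Countable ⊥
countable-⊥ = (λ ()) , λ {x} → ⊥-elim x

countable-⊤ : Countable ⊤
countable-⊤ = (λ _ → 0) , λ _ → refl

countable-Bool : Countable Bool
countable-Bool = (λ b → if b then 0 else 1) , inj
  where
  inj : ∀ {b b′} → (if b then 0 else 1) ≡ (if b′ then 0 else 1) → b ≡ b′
  inj {true}  {true}  _ = refl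
  inj {false} {false} _ = refl

countable-× : Countable A → Countable B → Countable (A × B)
countable-× (f , f-inj) (g , g-inj) = encode , λ e →
  let e′ = ⟪,⟫-injective _ _ _ _ e in cong₂ _,_ (f-inj (cong proj₁ e′)) (g-inj (cong proj₂ e′))
  where
  encode : _ × _ → ℕ
  encode (a , b) = ⟪ f a , g b ⟫

countable-↔ : Countable A → A ↔ B → Countable B
countable-↔ (f , f-inj) A↔B =
  f ∘ Inverse.from A↔B , λ e → Injection.injective (↔⇒↣ (↔-sym A↔B)) (f-inj e)

Part-≡ : {p : A → I} {i : I} {a a′ : A} {e : p a ≡ i} {e′ : p a′ ≡ i} →
         a ≡ a′ → _≡_ {A = Part p i} (a , e) (a′ , e′)
Part-≡ refl = cong (_ ,_) (uip _ _)

countable-Part : {p : A → I} {i : I} → Countable A → Countable (Part p i)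
countable-Part (f , f-inj) = f ∘ proj₁ , λ e → Part-≡ (f-inj e)

countable⇒≟ : Countable A → DecidableEquality A
countable⇒≟ (f , f-inj) = eq? (mk↣ f-inj)

does-true⇒ : {P : Set} (P? : Dec P) → does P? ≡ true → P
does-true⇒ (yes p) _ = p

does-false⇒ : {P : Set} (P? : Dec P) → does P? ≡ false → ¬ P
does-false⇒ (no ¬p) _ = ¬p

module StrongPCRProperties (R : StrongPCR) where
  open StrongPCR R

  ·-commutativeMonoid : CommutativeMonoid _ _
  ·-commutativeMonoid = record { isCommutativeMonoid = isCommMonoid }

  open IsCommutativeMonoid isCommMonoid public using (assoc; comm; identityˡ)
  open import Algebra.Properties.CommutativeSemigroup
    (CommutativeMonoid.commutativeSemigroup ·-commutativeMonoid) public
    using (interchange; xy∙z≈y∙xz)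

  private
    variable
      c m n z : Carrier

  ⊤-singleton : IsSingleton ⊤
  ⊤-singleton = tt , λ _ → refl

  Sum-cong : {x y : A → Carrier} → (∀ a → x a ≡ y a) → m ≡ n → Sum x m → Sum y n
  Sum-cong x≡y refl = Sum-ext x≡y

  Sum-reindex : {y : A → Carrier} → Countable A → (A↔B : A ↔ B) →
                Sum y m → Sum (y ∘ Inverse.from A↔B) m
  Sum-reindex {y = y} cA A↔B S
    with wpa cA (countable-↔ cA A↔B) y S (Inverse.to A↔B)
  ... | s , fibres , Ss =
    Sum-ext (λ b → Sum-functional (fibres b) (unary (fibre-singleton b) _)) Ss
    where
    open Inverse A↔B
    fibre-singleton : ∀ b → IsSingleton (Part to b)
    fibre-singleton b = (from b , strictlyInverseˡ b) ,
                        λ (a , e) → Part-≡ (trans (sym (strictlyInverseʳ a)) (cong from e))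

  Sum-empty : {x : A → Carrier} → Countable A → ¬ A → Sum x m → IsZero R m
  Sum-empty cA ¬a S =
    Sum-ext (λ ()) (Sum-reindex cA (mk↔ₛ′ ¬a ⊥-elim (λ ()) (λ a → ⊥-elim (¬a a))) S)

  split-off-zero : ∀ x → ∃[ z ] IsZero R z × Sum (λ b → if b then x else z) x
  split-off-zero x
    with wpa countable-⊤ countable-Bool (λ _ → x) (unary ⊤-singleton _) (λ _ → true)
  ... | s , fibres , Ss =
    s false ,
    Sum-empty (countable-Part countable-⊤) (λ { (_ , ()) }) (fibres false) ,
    Sum-ext (λ { true  → Sum-functional (fibres true)
                                         (unary ((tt , refl) , λ { (tt , refl) → refl }) _)
               ; false → refl })
            Ss

  0# : Carrier
  0# = proj₁ (split-off-zero one)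

  0#-isZero : IsZero R 0#
  0#-isZero = proj₁ (proj₂ (split-off-zero one))

  isZero⇒≡0# : IsZero R z → z ≡ 0#
  isZero⇒≡0# Z = Sum-functional Z 0#-isZero

  +-identityʳ : ∀ x → Sum (λ b → if b then x else 0#) x
  +-identityʳ x =
    let z , Z , S = split-off-zero x
    in  Sum-ext (λ { true → refl ; false → isZero⇒≡0# Z }) S

  Sum-zeros : Countable I → Sum (λ (_ : I) → 0#) 0#
  Sum-zeros cI
    with wpa countable-⊥ cI ⊥-elim 0#-isZero (λ ())
  ... | s , fibres , Ss =
    Sum-ext (λ i → isZero⇒≡0# (Sum-empty (countable-Part countable-⊥) (λ { (() , _) }) (fibres i)))
            Ss

  ·-zeroˡ : IsZero R z → ∀ y → IsZero R (z · y)
  ·-zeroˡ Z y = Sum-empty (countable-× countable-⊥ countable-⊤) (λ { (() , _) })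
                          (sum-mul countable-⊥ countable-⊤ Z (unary ⊤-singleton (λ _ → y)))

  Sum-·ʳ : {x : A → Carrier} → Countable A → Sum x m → ∀ c → Sum (λ a → x a · c) (m · c)
  Sum-·ʳ cA S c =
    Sum-reindex (countable-× cA countable-⊤) (mk↔ₛ′ proj₁ (_, tt) (λ _ → refl) (λ _ → refl))
                (sum-mul cA countable-⊤ S (unary ⊤-singleton (λ _ → c)))

  Sum-·ˡ : {x : A → Carrier} → Countable A → ∀ c → Sum x m → Sum (λ a → c · x a) (c · m)
  Sum-·ˡ cA c S = Sum-cong (λ a → comm _ c) (comm _ c) (Sum-·ʳ cA S c)

  Sum-cancelˡ : {x : A → Carrier} → Countable A → Invertible R c →
                Sum (λ a → c · x a) m → ∃ (Sum x)
  Sum-cancelˡ {c = c} {x = x} cA (k , c·k≡1) S = k · _ , Sum-ext k·c·x≡x (Sum-·ˡ cA k S)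
    where
    k·c·x≡x : ∀ a → k · (c · x a) ≡ x a
    k·c·x≡x a = begin
      k · (c · x a) ≡⟨ assoc k c (x a) ⟨
      (k · c) · x a ≡⟨ cong (_· x a) (trans (comm k c) c·k≡1) ⟩
      one · x a     ≡⟨ identityˡ (x a) ⟩
      x a           ∎
      where open ≡-Reasoning

  Invertible-· : Invertible R m → Invertible R n → Invertible R (m · n)
  Invertible-· {m} {n} (k , m·k≡1) (l , n·l≡1) =
    k · l , trans (interchange m n k l) (trans (cong₂ _·_ m·k≡1 n·l≡1) (identityˡ one))

  Sum-of-fibres : {x : A → Carrier} → Countable A → Countable I → (p : A → I) {s : I → Carrier} →
                  (∀ i → Sum (λ (q : Part p i) → x (proj₁ q)) (s i)) → Sum s m → Sum x m
  Sum-of-fibres {x = x} cA cI p fibres Ss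
    with pa cA cI x p _ fibres (_ , Ss)
  ... | n , Sx
    with wpa cA cI x Sx p
  ... | s′ , fibres′ , Ss′ =
    subst (Sum x) (Sum-functional (Sum-ext (λ i → Sum-functional (fibres′ i) (fibres i)) Ss′) Ss) Sx

  module _ {f : I × J → Carrier} (cI : Countable I) (cJ : Countable J) where

    row↔fibre : (i : I) → J ↔ Part proj₁ i
    row↔fibre i = mk↔ₛ′ (λ j → (i , j) , refl) (proj₂ ∘ proj₁)
                        (λ { ((_ , j) , refl) → refl }) (λ _ → refl)

    Sum-rows : Sum f m → ∃[ g ] (∀ i → Sum (λ j → f (i , j)) (g i)) × Sum g m
    Sum-rows S
      with wpa (countable-× cI cJ) cI f S proj₁
    ... | g , fibres , Sg =
      g ,
      (λ i → Sum-reindex (countable-Part (countable-× cI cJ)) (↔-sym (row↔fibre i)) (fibres i)) ,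
      Sg

    Sum-by-rows : {g : I → Carrier} → Sum f m → (∀ i → Sum (λ j → f (i , j)) (g i)) → Sum g m
    Sum-by-rows S rows =
      let g′ , rows′ , Sg′ = Sum-rows S
      in  Sum-ext (λ i → Sum-functional (rows′ i) (rows i)) Sg′

    Sum-of-rows : {g : I → Carrier} → (∀ i → Sum (λ j → f (i , j)) (g i)) → Sum g m → Sum f m
    Sum-of-rows rows =
      Sum-of-fibres (countable-× cI cJ) cI proj₁
        (λ i → Sum-ext (λ { ((_ , j) , refl) → refl }) (Sum-reindex cJ (row↔fibre i) (rows i)))

  module _ {f : I × J → Carrier} (cI : Countable I) (cJ : Countable J) where

    Sum-swap : Sum f m → Sum (f ∘ swap) m
    Sum-swap = Sum-reindex (countable-× cI cJ) (×-comm I J)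

    Sum-columns : Sum f m → ∃[ g ] (∀ j → Sum (λ i → f (i , j)) (g j)) × Sum g m
    Sum-columns S = Sum-rows cJ cI (Sum-swap S)

    Sum-by-columns : {g : J → Carrier} → Sum f m → (∀ j → Sum (λ i → f (i , j)) (g j)) → Sum g m
    Sum-by-columns S = Sum-by-rows cJ cI (Sum-swap S)

  Sum-supported-at : {x : A → Carrier} → Countable A → (a : A) →
                     (∀ b → b ≢ a → IsZero R (x b)) → Sum x (x a)
  Sum-supported-at {x = x} cA a x-zero =
    Sum-of-fibres cA countable-Bool is-a fibres (+-identityʳ (x a))
    where
    is-a : _ → Bool
    is-a b = does (countable⇒≟ cA b a)
    fibres : ∀ i → Sum (λ (q : Part is-a i) → x (proj₁ q)) (if i then x a else 0#)
    fibres true  = unary ((a , dec-true (countable⇒≟ cA a a) refl) ,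
                          λ (b , e) → Part-≡ (does-true⇒ (countable⇒≟ cA b a) e)) _
    fibres false =
      Sum-ext (λ (b , e) → sym (isZero⇒≡0# (x-zero b (does-false⇒ (countable⇒≟ cA b a) e))))
              (Sum-zeros (countable-Part cA))

  Sum-δ : Countable A → (d : A → Carrier) (a : A) →
          d a ≡ one → (∀ b → b ≢ a → IsZero R (d b)) →
          (g : A → Carrier) → Sum (λ b → d b · g b) (g a)
  Sum-δ cA d a da≡1 d-zero g =
    subst (Sum _) (trans (cong (_· g a) da≡1) (identityˡ (g a)))
          (Sum-supported-at cA a (λ b b≢a → ·-zeroˡ (d-zero b b≢a) (g b)))

module SpaceProperties (R : StrongPCR) (𝓑 : StrongPCR.Carrier R → Set) where
  open StrongPCR R
  open StrongPCRProperties R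

  MatProd-identityˡ : Countable A → {i : Vect R 𝓑 (A × A)} {s : Vect R 𝓑 (A × B)} →
                      IsIdMatrix R 𝓑 A i → MatProd R 𝓑 i s s
  MatProd-identityˡ cA {i} {s} i-id a c =
    Sum-δ cA (λ b → i (a , b)) a (proj₁ (i-id a a) refl) (λ b b≢a → proj₂ (i-id a b) (b≢a ∘ sym))
          (λ b → s (b , c))

  MatProd-identityʳ : Countable B → {s : Vect R 𝓑 (A × B)} {j : Vect R 𝓑 (B × B)} →
                      IsIdMatrix R 𝓑 B j → MatProd R 𝓑 s j s
  MatProd-identityʳ cB {s} {j} j-id a c =
    Sum-ext (λ b → comm _ _)
      (Sum-δ cB (λ b → j (b , c)) c (proj₁ (j-id c c) refl) (λ b → proj₂ (j-id b c))
             (λ b → s (a , b)))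

  MatProd-assoc : Countable B → Countable C →
                  {s : Vect R 𝓑 (A × B)} {t : Vect R 𝓑 (B × C)} {u : Vect R 𝓑 (C × D)}
                  {st : Vect R 𝓑 (A × C)} {tu : Vect R 𝓑 (B × D)} {st-u s-tu : Vect R 𝓑 (A × D)} →
                  MatProd R 𝓑 s t st → MatProd R 𝓑 st u st-u →
                  MatProd R 𝓑 t u tu → MatProd R 𝓑 s tu s-tu →
                  ∀ a d → st-u (a , d) ≡ s-tu (a , d)
  MatProd-assoc cB cC {s} {t} {u} {s-tu = s-tu} st-sum st-u-sum tu-sum s-tu-sum a d =
    Sum-functional (st-u-sum a d)
      (Sum-by-columns cB cC double-sum (λ c → Sum-·ʳ cB (st-sum a c) (u (c , d))))
    where
    double-sum : Sum (λ (b , c) → (s (a , b) · t (b , c)) · u (c , d)) (s-tu (a , d))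
    double-sum = Sum-of-rows cB cC
      (λ b → Sum-ext (λ c → sym (assoc _ _ _)) (Sum-·ˡ cC (s (a , b)) (tu-sum b d)))
      (s-tu-sum a d)

  _⊗_ : Vect R 𝓑 A → Vect R 𝓑 B → Vect R 𝓑 (A × B)
  (x ⊗ y) (a , b) = x a · y b

  Orth-sym : {x y : Vect R 𝓑 A} → Orth R 𝓑 x y → Orth R 𝓑 y x
  Orth-sym (m , S , m∈𝓑) = m , Sum-ext (λ a → comm _ _) S , m∈𝓑

  ⊆-Perp-Perp : {F : Vect R 𝓑 A → Set} {x : Vect R 𝓑 A} → F x → Perp R 𝓑 (Perp R 𝓑 F) x
  ⊆-Perp-Perp x∈F y y∈F⊥ = Orth-sym (y∈F⊥ _ x∈F)

  module _ (X Y : Space R 𝓑) {s : Vect R 𝓑 (Web X × Web Y)} where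

    PLolli⇒Orth-⊗ : {x : Vect R 𝓑 (Web X)} {y′ : Vect R 𝓑 (Web Y)} →
                    PLolli R 𝓑 X Y s → P X x → Perp R 𝓑 (P Y) y′ → Orth R 𝓑 (x ⊗ y′) s
    PLolli⇒Orth-⊗ s∈ x∈ y′∈ = s∈ _ (⊆-Perp-Perp (_ , _ , x∈ , y′∈ , λ _ _ → refl))

    Orth-⊗⇒PLolli : (∀ {x y′} → P X x → Perp R 𝓑 (P Y) y′ → Orth R 𝓑 (x ⊗ y′) s) →
                    PLolli R 𝓑 X Y s
    Orth-⊗⇒PLolli orth = ⊆-Perp-Perp s⊥tensors
      where
      s⊥tensors : Perp R 𝓑 (TensorSet R 𝓑 (P X) (Perp R 𝓑 (P Y))) s
      s⊥tensors w (x , y′ , x∈ , y′∈ , w≡x⊗y′) =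
        let m , S , m∈𝓑 = orth x∈ y′∈
        in  m , Sum-ext (λ q → cong (_· s q) (sym (w≡x⊗y′ _ _))) S , m∈𝓑

  MatApp : Vect R 𝓑 (A × B) → Vect R 𝓑 A → Vect R 𝓑 B → Set
  MatApp s x v = ∀ b → Sum (λ a → x a · s (a , b)) (v b)

  PLolli-apply : (X Y : Space R 𝓑) {s : Vect R 𝓑 (Web X × Web Y)} {x : Vect R 𝓑 (Web X)} →
                 PLolli R 𝓑 X Y s → P X x → ∃[ v ] MatApp s x v × P Y v
  PLolli-apply X Y {s} {x} s∈ x∈ = v , v-sum , P⊥⊥⊆P Y v v∈P⊥⊥
    where
    cX : Countable (Web X)
    cX = web-count X
    cY : Countable (Web Y)
    cY = web-count Y
    entry : ∀ b → ∃ (Sum (λ a → x a · s (a , b)))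
    entry b =
      let y′ , y′∈ , y′b-inv = P⊥-covering Y b
          _ , S , _          = PLolli⇒Orth-⊗ X Y s∈ x∈ y′∈
          _ , columns , _    = Sum-columns cX cY S
      in  Sum-cancelˡ cX y′b-inv (Sum-ext (λ a → xy∙z≈y∙xz (x a) (y′ b) (s (a , b))) (columns b))
    v : Vect R 𝓑 (Web Y)
    v b = proj₁ (entry b)
    v-sum : MatApp s x v
    v-sum b = proj₂ (entry b)
    v∈P⊥⊥ : Perp R 𝓑 (Perp R 𝓑 (P Y)) v
    v∈P⊥⊥ y′ y′∈ =
      let m , S , m∈𝓑 = PLolli⇒Orth-⊗ X Y s∈ x∈ y′∈
      in  m , Sum-by-columns cX cY S (λ b → Sum-ext (λ a → sym (xy∙z≈y∙xz (x a) (y′ b) (s (a , b))))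
                                                     (Sum-·ˡ cX (y′ b) (v-sum b))) , m∈𝓑

  chain : Vect R 𝓑 A → Vect R 𝓑 (A × B) → Vect R 𝓑 (B × C) → Vect R 𝓑 C → Vect R 𝓑 ((A × C) × B)
  chain x s t z ((a , c) , b) = (x a · z c) · (s (a , b) · t (b , c))

  module _ (X Y Z : Space R 𝓑) {s : Vect R 𝓑 (Web X × Web Y)} {t : Vect R 𝓑 (Web Y × Web Z)}
           (s∈ : PLolli R 𝓑 X Y s) (t∈ : PLolli R 𝓑 Y Z t) where

    private
      cX : Countable (Web X)
      cX = web-count X
      cY : Countable (Web Y)
      cY = web-count Y
      cZ : Countable (Web Z)
      cZ = web-count Z

    chain-summable : {x : Vect R 𝓑 (Web X)} {z : Vect R 𝓑 (Web Z)} →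
                     P X x → Perp R 𝓑 (P Z) z → ∃[ m ] Sum (chain x s t z) m × 𝓑 m
    chain-summable {x} {z} x∈ z∈ =
      let v , v-sum , v∈ = PLolli-apply X Y s∈ x∈
          m , S , m∈𝓑    = PLolli⇒Orth-⊗ Y Z t∈ v∈ z∈
      in  m , Sum-reindex (countable-× (countable-× cY cZ) cX) regroup
                          (Sum-of-rows (countable-× cY cZ) cX (rows v-sum) S) , m∈𝓑
      where
      rows : ∀ {v} → MatApp s x v → ∀ ((b , c) : Web Y × Web Z) →
             Sum (λ a → chain x s t z ((a , c) , b)) ((v ⊗ z) (b , c) · t (b , c))
      rows {v} v-sum (b , c) =
        Sum-cong (λ a → interchange (x a) (s (a , b)) (z c) (t (b , c)))
                 (sym (assoc (v b) (z c) (t (b , c))))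
                 (Sum-·ʳ cX (v-sum b) (z c · t (b , c)))
      regroup : ((Web Y × Web Z) × Web X) ↔ ((Web X × Web Z) × Web Y)
      regroup = mk↔ₛ′ (λ ((b , c) , a) → (a , c) , b) (λ ((a , c) , b) → (b , c) , a)
                      (λ _ → refl) (λ _ → refl)

    PLolli-∘ : ∃[ u ] MatProd R 𝓑 s t u × PLolli R 𝓑 X Z u
    PLolli-∘ = u , u-sum , Orth-⊗⇒PLolli X Z u-orth
      where
      entry : ∀ a c → ∃ (Sum (λ b → s (a , b) · t (b , c)))
      entry a c =
        let x , x∈ , xa-inv = P-covering X a
            z , z∈ , zc-inv = P⊥-covering Z c
            _ , S , _       = chain-summable x∈ z∈
            _ , rows , _    = Sum-rows (countable-× cX cZ) cY S
        in  Sum-cancelˡ cY (Invertible-· xa-inv zc-inv) (rows (a , c))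
      u : Vect R 𝓑 (Web X × Web Z)
      u (a , c) = proj₁ (entry a c)
      u-sum : MatProd R 𝓑 s t u
      u-sum a c = proj₂ (entry a c)
      u-orth : ∀ {x z} → P X x → Perp R 𝓑 (P Z) z → Orth R 𝓑 (x ⊗ z) u
      u-orth {x} {z} x∈ z∈ =
        let m , S , m∈𝓑 = chain-summable x∈ z∈
        in  m , Sum-by-rows (countable-× cX cZ) cY S
                              (λ (a , c) → Sum-·ˡ cY (x a · z c) (u-sum a c)) , m∈𝓑

  δ : Countable A → Vect R 𝓑 (A × A)
  δ cA (a , a′) with countable⇒≟ cA a a′
  ... | yes _ = one
  ... | no  _ = 0#

  δ-isIdMatrix : (cA : Countable A) → IsIdMatrix R 𝓑 A (δ cA)
  δ-isIdMatrix cA a a′ with countable⇒≟ cA a a′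
  ... | yes a≡a′ = (λ _ → refl) , (λ a≢a′ → ⊥-elim (a≢a′ a≡a′))
  ... | no  a≢a′ = (λ a≡a′ → ⊥-elim (a≢a′ a≡a′)) , (λ _ → 0#-isZero)

  δ∈PLolli : (X : Space R 𝓑) → PLolli R 𝓑 X X (δ (web-count X))
  δ∈PLolli X = Orth-⊗⇒PLolli X X δ-orth
    where
    cX : Countable (Web X)
    cX = web-count X
    δ-orth : ∀ {x x′} → P X x → Perp R 𝓑 (P X) x′ → Orth R 𝓑 (x ⊗ x′) (δ cX)
    δ-orth {x} {x′} x∈ x′∈ =
      let m , S , m∈𝓑 = x′∈ x x∈
      in  m , Sum-of-rows cX cX (λ a → Sum-ext (λ a′ → comm _ _) (row a)) S , m∈𝓑
      where
      row : ∀ a → Sum (λ a′ → δ cX (a , a′) · (x a · x′ a′)) (x a · x′ a)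
      row a = MatProd-identityˡ cX {s = λ (b , c) → x c · x′ b} (δ-isIdMatrix cX) a a

theorem2p6 : (R : StrongPCR) (𝓑 : StrongPCR.Carrier R → Set) → DownClosed R 𝓑 →
    (X Y Z : Space R 𝓑) →
    -- composition: t · s is well-defined and lies in P(X ⊸ Z)
    (∀ s t → PLolli R 𝓑 X Y s → PLolli R 𝓑 Y Z t →
      ∃[ u ] MatProd R 𝓑 s t u × PLolli R 𝓑 X Z u)
    -- identity: id_X ∈ P(X ⊸ X)
    × (∃[ i ] IsIdMatrix R 𝓑 (Web X) i × PLolli R 𝓑 X X i)
    -- category laws: unit laws
    × (∀ s i j → PLolli R 𝓑 X Y s → IsIdMatrix R 𝓑 (Web X) i →
        IsIdMatrix R 𝓑 (Web Y) j → MatProd R 𝓑 i s s × MatProd R 𝓑 s j s)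
    -- category laws: associativity
    × (∀ (W : Space R 𝓑) s t u st tu st-u s-tu →
        PLolli R 𝓑 X Y s → PLolli R 𝓑 Y Z t → PLolli R 𝓑 Z W u →
        MatProd R 𝓑 s t st → MatProd R 𝓑 st u st-u →
        MatProd R 𝓑 t u tu → MatProd R 𝓑 s tu s-tu →
        ∀ a d → st-u (a , d) ≡ s-tu (a , d))
theorem2p6 R 𝓑 _ X Y Z =
    (λ _ _ → PLolli-∘ X Y Z)
  , (δ cX , δ-isIdMatrix cX , δ∈PLolli X)
  , (λ _ _ _ _ i-id j-id → MatProd-identityˡ cX i-id , MatProd-identityʳ (web-count Y) j-id)
  , (λ _ _ _ _ _ _ _ _ _ _ _ → MatProd-assoc (web-count Y) (web-count Z))
  where
  open SpaceProperties R 𝓑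
  cX : Countable (Web X)
  cX = web-count X
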